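{- Let $D=(V,A)$ be a loopless, weakly connected digraph with at least two nodes, let $D^*=(V^*,A^*)$ and $c^*$ be as defined in the context, and let $\pi^*=(\pi_{\rm o},\pi,\pi_{\rm i})$ be an integer-valued $c^*$-feasible potential on $V^*$. Then the restriction $\pi$ of $\pi^*$ to $V$ satisfies $\Delta_\pi(e)\in\{0,1\}$ for every arc $e\in A$.
   Context: Let $\overleftrightarrow{A}=A\cup\overleftarrow{A}$ where $\overleftarrow{A}$ consists of the reverses of the arcs of $A$. Let $V_{\rm o}=\{v_{\rm o}:v\in V\}$ and $V_{\rm i}=\{v_{\rm i}:v\in V\}$ be disjoint copies of $V$ and $V^*=V_{\rm o}\cup V\cup V_{\rm i}$. The arc set $A^*$ consists of the vertical arcs $v_{\rm i}v$ and $vv_{\rm o}$ for each $v\in V$, and, for each arc $uv\in\overleftrightarrow{A}$, the arcs $uv$, $uv_{\rm i}$, $u_{\rm o}v$. The cost $c^*:A^*\to\{0,1\}$ is $1$ on the arcs $uv$, $uv_{\rm i}$, $u_{\rm o}v$ with $uv\in A$, and $0$ on all other arcs (including those arising from $\overleftarrow{A}$ and the vertical arcs). A potential $\pi^*$ on $V^*$ is $c^*$-feasible if $\Delta_{\pi^*}(a)=\pi^*(\text{head}(a))-\pi^*(\text{tail}(a))\le c^*(a)$ for every $a\in A^*$. $\pi_{\rm o},\pi,\pi_{\rm i}$ denote the restrictions of $\pi^*$ to $V_{\rm o},V,V_{\rm i}$, and $\Delta_\pi(uv)=\pi(v)-\pi(u)$. -}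

module Defs where

open import Data.Nat using (ℕ)
open import Data.Fin using (Fin)
open import Data.Integer using (ℤ; _-_; _≤_; +_)
open import Data.Product using (_×_; _,_)
open import Data.Sum using (_⊎_)
open import Data.List using (List)
open import Data.List.Membership.Propositional using (_∈_)
open import Relation.Binary.PropositionalEquality using (_≢_)
open import Relation.Binary.Construct.Closure.ReflexiveTransitive using (Star)

-- A digraph D = (V, A) with V = Fin n and A a list of arcs (u , v) = uv
-- (a list, so parallel arcs are allowed).
record Digraph : Set where
  field
    n    : ℕ
    arcs : List (Fin n × Fin n)
open Digraph public

Node : Digraph → Set
Node D = Fin (n D)

InArc : (D : Digraph) → Node D × Node D → Set
InArc D e = e ∈ arcs D
syntax InArc D e = e ∈A[ D ]

Loopless : Digraph → Set
Loopless D = ∀ {u v} → (u , v) ∈A[ D ] → u ≢ v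

Adj : (D : Digraph) → Node D → Node D → Set
Adj D u v = ((u , v) ∈A[ D ]) ⊎ ((v , u) ∈A[ D ])

WeaklyConnected : Digraph → Set
WeaklyConnected D = ∀ (u v : Node D) → Star (Adj D) u v

data NodeStar (D : Digraph) : Set where
  o_ : Node D → NodeStar D
  m_ : Node D → NodeStar D
  i_ : Node D → NodeStar D

-- A* : vertical arcs v_i v and v v_o, and for each uv ∈ ↔A the arcs
-- uv, u v_i, u_o v.  Arcs coming from A and from ←A are kept distinct
-- (constructors fwd-* carry a proof uv ∈ A, bwd-* a proof vu ∈ A, i.e. the
-- arc uv of ←A is the reverse of vu ∈ A).
data ArcStar (D : Digraph) : Set where
  vert-in  : Node D → ArcStar D
  vert-out : Node D → ArcStar D
  fwd-mm fwd-mi fwd-om : ∀ u v → (u , v) ∈A[ D ] → ArcStar D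
  bwd-mm bwd-mi bwd-om : ∀ u v → (v , u) ∈A[ D ] → ArcStar D

tailS headS : ∀ {D} → ArcStar D → NodeStar D
tailS (vert-in v)      = i v
tailS (vert-out v)     = m v
tailS (fwd-mm u v _)   = m u
tailS (fwd-mi u v _)   = m u
tailS (fwd-om u v _)   = o u
tailS (bwd-mm u v _)   = m u
tailS (bwd-mi u v _)   = m u
tailS (bwd-om u v _)   = o u
headS (vert-in v)      = m v
headS (vert-out v)     = o v
headS (fwd-mm u v _)   = m v
headS (fwd-mi u v _)   = i v
headS (fwd-om u v _)   = m v
headS (bwd-mm u v _)   = m v
headS (bwd-mi u v _)   = i v
headS (bwd-om u v _)   = m v

costS : ∀ {D} → ArcStar D → ℕ
costS (fwd-mm _ _ _) = 1
costS (fwd-mi _ _ _) = 1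
costS (fwd-om _ _ _) = 1
costS _              = 0

ΔS : ∀ {D} → (NodeStar D → ℤ) → ArcStar D → ℤ
ΔS π* a = π* (headS a) - π* (tailS a)

Feasible : ∀ {D} → (NodeStar D → ℤ) → Set
Feasible {D} π* = ∀ (a : ArcStar D) → ΔS π* a ≤ + costS a

restrict : ∀ {D} → (NodeStar D → ℤ) → Node D → ℤ
restrict π* v = π* (m v)

Δ : ∀ {D} → (Node D → ℤ) → Node D × Node D → ℤ
Δ π (u , v) = π v - π u

{-# OPTIONS --safe #-}
module Submission where

-- The claim is local to a single arc uv ∈ A: its copy uv in D* costs 1, so
-- Δ_π(uv) ≤ 1, and the reverse arc vu ∈ ←A costs 0, so Δ_π(vu) = −Δ_π(uv) ≤ 0.

open import Defs
open import Data.Nat using (_≥_; suc; s≤s)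
open import Data.Integer using (ℤ; +_; -[1+_]; _≤_; +≤+)
open import Data.Integer.Properties using (i-j≤0⇒i≤j; i≤j⇒0≤j-i)
open import Data.Product using (_×_; _,_)
open import Data.Sum using (_⊎_; inj₁; inj₂)
open import Relation.Binary.PropositionalEquality using (_≡_; refl)

0≤i≤1⇒i≡0⊎i≡1 : ∀ {i : ℤ} → + 0 ≤ i → i ≤ + 1 → i ≡ + 0 ⊎ i ≡ + 1
0≤i≤1⇒i≡0⊎i≡1 {+ 0} _ _ = inj₁ refl
0≤i≤1⇒i≡0⊎i≡1 {+ 1} _ _ = inj₂ refl
0≤i≤1⇒i≡0⊎i≡1 {+ suc (suc _)} _ (+≤+ (s≤s ()))
0≤i≤1⇒i≡0⊎i≡1 { -[1+ _ ]} () _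

module _ {D : Digraph} (π* : NodeStar D → ℤ) (feasible : Feasible π*) where

  Δ-restrict≤1 : ∀ {u v} → (u , v) ∈A[ D ] → Δ {D} (restrict π*) (u , v) ≤ + 1
  Δ-restrict≤1 {u} {v} uv = feasible (fwd-mm u v uv)

  0≤Δ-restrict : ∀ {u v} → (u , v) ∈A[ D ] → + 0 ≤ Δ {D} (restrict π*) (u , v)
  0≤Δ-restrict {u} {v} uv = i≤j⇒0≤j-i {π* (m u)} {π* (m v)} (i-j≤0⇒i≤j (feasible (bwd-mm v u uv)))

claim4p2 : (D : Digraph) → Loopless D → WeaklyConnected D → n D ≥ 2 →
    (π* : NodeStar D → ℤ) → Feasible π* →
    (e : Node D × Node D) → e ∈A[ D ] → (Δ {D} (restrict π*) e ≡ + 0) ⊎ (Δ {D} (restrict π*) e ≡ + 1)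
claim4p2 D _ _ _ π* feasible (u , v) uv =
  0≤i≤1⇒i≡0⊎i≡1 (0≤Δ-restrict π* feasible uv) (Δ-restrict≤1 π* feasible uv)
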